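{- Let $G$ be a connected graph with $n$ vertices and diameter $d$. If $d>n/2$, then $\sigma_0(G)<d$ and $\sigma_1(G)<nd^2$.
   Context: For a connected graph $G$ and a vertex $u$, the eccentricity $\varepsilon_G(u)$ is $\max_{v\in V(G)} d_G(u,v)$. The average eccentricity is $\sigma_0(G)=\frac{1}{|V(G)|}\sum_{u\in V(G)}\varepsilon_G(u)$ and the first Zagreb eccentricity index is $\sigma_1(G)=\sum_{u\in V(G)}\varepsilon_G(u)^2$. Graphs are finite, simple and undirected. -}

module Defs where

open import Level using (0ℓ)
open import Data.Nat using (ℕ; zero; suc; _+_; _*_; _≤_; _⊔_)
open import Data.Fin using (Fin)
open import Data.List using (List; foldr; map)
open import Data.Nat.ListAction using (sum)
open import Data.List using (allFin) public
open import Data.Product using (_×_; ∃)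
open import Relation.Nullary using (¬_)

record Graph (n : ℕ) : Set₁ where
  field
    Adj     : Fin n → Fin n → Set
    irrefl  : ∀ u → ¬ Adj u u
    sym     : ∀ {u v} → Adj u v → Adj v u
open Graph public

data Walk {n : ℕ} (G : Graph n) : Fin n → Fin n → ℕ → Set where
  here : ∀ {u} → Walk G u u 0
  step : ∀ {u w v k} → Adj G u w → Walk G w v k → Walk G u v (suc k)

Connected : ∀ {n} → Graph n → Set
Connected G = ∀ u v → ∃ λ k → Walk G u v k

IsDistance : ∀ {n} → Graph n → (Fin n → Fin n → ℕ) → Set
IsDistance G δ = ∀ u v → Walk G u v (δ u v) × (∀ k → Walk G u v k → δ u v ≤ k)

maxOver : ∀ {n} → (Fin n → ℕ) → ℕ
maxOver {n} f = foldr (λ x m → f x ⊔ m) 0 (allFin n)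

sumOver : ∀ {n} → (Fin n → ℕ) → ℕ
sumOver {n} f = sum (map f (allFin n))

ecc : ∀ {n} → (Fin n → Fin n → ℕ) → Fin n → ℕ
ecc δ u = maxOver (δ u)

diam : ∀ {n} → (Fin n → Fin n → ℕ) → ℕ
diam δ = maxOver (ecc δ)

-- σ₀(G) = (1/n) Σ ε(u); we record the numerator n·σ₀(G) = Σ ε(u)
sumEcc : ∀ {n} → (Fin n → Fin n → ℕ) → ℕ
sumEcc δ = sumOver (ecc δ)

sigma1 : ∀ {n} → (Fin n → Fin n → ℕ) → ℕ
sigma1 δ = sumOver (λ u → ecc δ u * ecc δ u)

-- Let d be the diameter. If some vertex has eccentricity below d, both
-- inequalities are strict because every eccentricity is at most d. Otherwise G
-- is self-centred; fix c and a vertex z with d(c,z) = d. For 0 < j < d the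
-- level {v : d(c,v) = j} has at least two vertices: were v its only vertex, it
-- would lie on every geodesic from level ≤ j to level ≥ j, and the vertex y with
-- d(v,y) = d would force a geodesic longer than d, either from y to z or from c
-- to y. With c and z this gives 2d vertices, contradicting n < 2d.
module Submission where

open import Defs renaming (sym to Adj-sym)
open import Data.Nat using (ℕ; zero; suc; _+_; _*_; _<_; _≤_; _⊔_; _%_; NonZero; >-nonZero⁻¹; z≤n; s≤s; z<s; _≟_; _<?_)
open import Data.Nat.Properties
open import Data.Nat.DivMod using (n%n≡0; m<n⇒m%n≡m)
open import Data.Nat.ListAction using (sum)
open import Data.Fin using (Fin)
import Data.Fin.Properties as Fin
open import Data.List using ([]; _∷_; foldr; map; length)
open import Data.List.Properties using (length-tabulate)
open import Data.List.Membership.Propositional using (_∈_)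
open import Data.List.Membership.Propositional.Properties using (∈-allFin)
open import Data.List.Relation.Unary.Any using (here; there)
open import Data.Vec using (Vec; []; _∷_; lookup)
open import Data.Vec.Relation.Unary.All as All using (All; []; _∷_)
open import Data.Vec.Relation.Unary.AllPairs using ([]; _∷_)
open import Data.Vec.Relation.Unary.Unique.Propositional using (Unique)
open import Data.Vec.Relation.Unary.Unique.Propositional.Properties using (lookup-injective)
open import Data.Product using (_×_; _,_; ∃; ∃₂; Σ; proj₁; proj₂)
open import Data.Sum using (inj₁; inj₂)
open import Data.Empty using (⊥; ⊥-elim)
open import Relation.Nullary using (yes; no)
open import Relation.Nullary.Decidable using (¬?; _×-dec_; decidable-stable)
open import Relation.Binary.PropositionalEquality
  using (_≡_; _≢_; refl; sym; trans; cong; cong₂; subst)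

max-upper : ∀ {A : Set} (f : A → ℕ) {x xs} → x ∈ xs → f x ≤ foldr (λ y m → f y ⊔ m) 0 xs
max-upper f {xs = y ∷ ys} (here refl) = m≤m⊔n (f y) _
max-upper f {xs = y ∷ ys} (there x∈ys) = ≤-trans (max-upper f x∈ys) (m≤n⊔m (f y) _)

max-attained : ∀ {A : Set} (f : A → ℕ) xs → 0 < foldr (λ y m → f y ⊔ m) 0 xs →
               ∃ λ x → f x ≡ foldr (λ y m → f y ⊔ m) 0 xs
max-attained f (y ∷ ys) 0<max with ⊔-sel (f y) (foldr (λ y m → f y ⊔ m) 0 ys)
... | inj₁ max≡fy = y , sym max≡fy
... | inj₂ max≡rest with x , fx≡rest ← max-attained f ys (subst (0 <_) max≡rest 0<max) =
  x , trans fx≡rest (sym max≡rest)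

sum-map-< : ∀ {A : Set} (f : A → ℕ) {m x} xs → (∀ y → f y ≤ m) → x ∈ xs → f x < m →
            sum (map f xs) < length xs * m
sum-map-< f {m} (y ∷ ys) f≤m (here refl) fx<m = +-mono-<-≤ fx<m (sum-map-≤ ys)
  where
    sum-map-≤ : ∀ zs → sum (map f zs) ≤ length zs * m
    sum-map-≤ []       = z≤n
    sum-map-≤ (z ∷ zs) = +-mono-≤ (f≤m z) (sum-map-≤ zs)
sum-map-< f (y ∷ ys) f≤m (there x∈ys) fx<m = +-mono-≤-< (f≤m y) (sum-map-< f ys f≤m x∈ys fx<m)

maxOver-upper : ∀ {n} (f : Fin n → ℕ) x → f x ≤ maxOver f
maxOver-upper f x = max-upper f (∈-allFin x)

maxOver-attained : ∀ {n} (f : Fin n → ℕ) → 0 < maxOver f → ∃ λ x → f x ≡ maxOver f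
maxOver-attained {n} f = max-attained f (allFin n)

sumOver-< : ∀ {n m} (f : Fin n → ℕ) → (∀ x → f x ≤ m) → ∀ x → f x < m → sumOver f < n * m
sumOver-< {n} {m} f f≤m x fx<m =
  subst (λ k → sumOver f < k * m) (length-tabulate {n = n} (λ i → i))
        (sum-map-< f (allFin n) f≤m (∈-allFin x) fx<m)

module _ {n} (h : Fin n → ℕ) where

  TwoAtLevel : ℕ → Set
  TwoAtLevel j = ∃₂ λ a b → a ≢ b × h a ≡ j × h b ≡ j

  levels-vector : ∀ m → (∀ j → j < m → TwoAtLevel j) →
                  Σ (Vec (Fin n) (m * 2)) λ xs → Unique xs × All (λ x → h x < m) xs
  levels-vector zero    two = [] , [] , []
  levels-vector (suc m) two
    with a , b , a≢b , ha≡m , hb≡m ← two m ≤-refl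
       | xs , unique-xs , xs<m ← levels-vector m (λ j j<m → two j (m<n⇒m<1+n j<m))
    = a ∷ b ∷ xs
    , (a≢b ∷ fresh ha≡m) ∷ fresh hb≡m ∷ unique-xs
    , ≤-reflexive (cong suc ha≡m) ∷ ≤-reflexive (cong suc hb≡m) ∷ All.map m<n⇒m<1+n xs<m
    where
      fresh : ∀ {x} → h x ≡ m → All (x ≢_) xs
      fresh hx≡m = All.map (λ hy<m x≡y → <-irrefl (trans (sym (cong h x≡y)) hx≡m) hy<m) xs<m

  twoPerLevel⇒≤ : ∀ m → (∀ j → j < m → TwoAtLevel j) → m * 2 ≤ n
  twoPerLevel⇒≤ m two with xs , unique-xs , _ ← levels-vector m two =
    Fin.injective⇒≤ (λ {i} {j} → lookup-injective unique-xs i j)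

_++ʷ_ : ∀ {n} {G : Graph n} {a b c k m} → Walk G a b k → Walk G b c m → Walk G a c (k + m)
here     ++ʷ w′ = w′
step e w ++ʷ w′ = step e (w ++ʷ w′)

module Distance {n} {G : Graph n} {δ : Fin n → Fin n → ℕ} (isδ : IsDistance G δ) where

  open ≤-Reasoning

  geodesic : ∀ u v → Walk G u v (δ u v)
  geodesic u v = proj₁ (isδ u v)

  δ-minimal : ∀ {u v k} → Walk G u v k → δ u v ≤ k
  δ-minimal {u} {v} {k} w = proj₂ (isδ u v) k w

  δ-refl : ∀ {u} → δ u u ≡ 0
  δ-refl = n≤0⇒n≡0 (δ-minimal here)

  δ-triangle : ∀ {u v w} → δ u w ≤ δ u v + δ v w
  δ-triangle {u} {v} {w} = δ-minimal (geodesic u v ++ʷ geodesic v w)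

  δ-edge : ∀ {u w} → Adj G u w → δ u w ≤ 1
  δ-edge e = δ-minimal (step e here)

  walk⇒δ-reverse : ∀ {u v k} → Walk G u v k → δ v u ≤ k
  walk⇒δ-reverse here = ≤-reflexive δ-refl
  walk⇒δ-reverse {u} {v} (step {w = w} {k = k} e walk) = begin
    δ v u           ≤⟨ δ-triangle ⟩
    δ v w + δ w u   ≤⟨ +-mono-≤ (walk⇒δ-reverse walk) (δ-edge (Adj-sym G e)) ⟩
    k + 1           ≡⟨ +-comm k 1 ⟩
    suc k           ∎

  δ-sym : ∀ {u v} → δ u v ≡ δ v u
  δ-sym {u} {v} = ≤-antisym (walk⇒δ-reverse (geodesic v u)) (walk⇒δ-reverse (geodesic u v))

  δ-edge-lipschitz : ∀ {c u w} → Adj G u w → δ c w ≤ suc (δ c u)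
  δ-edge-lipschitz {c} {u} {w} e = begin
    δ c w           ≤⟨ δ-triangle ⟩
    δ c u + δ u w   ≤⟨ +-monoʳ-≤ (δ c u) (δ-edge e) ⟩
    δ c u + 1       ≡⟨ +-comm (δ c u) 1 ⟩
    suc (δ c u)     ∎

  walk-crosses-level : ∀ c j {a b k} → Walk G a b k → δ c a ≤ j → j ≤ δ c b →
                       ∃ λ v → δ c v ≡ j × δ a v + δ v b ≤ k
  walk-crosses-level c j {a} here ca≤j j≤ca =
    a , ≤-antisym ca≤j j≤ca , ≤-reflexive (cong₂ _+_ δ-refl δ-refl)
  walk-crosses-level c j {a} {b} (step {w = w} {k = k} e walk) ca≤j j≤cb with δ c a ≟ j
  ... | yes ca≡j = a , ca≡j , subst (_≤ suc k) (sym (cong (_+ δ a b) δ-refl)) (δ-minimal (step e walk))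
  ... | no ca≢j
    with v , cv≡j , split ← walk-crosses-level c j walk (≤-trans (δ-edge-lipschitz e) (≤∧≢⇒< ca≤j ca≢j)) j≤cb =
    v , cv≡j , (begin
      δ a v + δ v b           ≤⟨ +-monoˡ-≤ (δ v b) δ-triangle ⟩
      δ a w + δ w v + δ v b   ≤⟨ +-monoˡ-≤ (δ v b) (+-monoˡ-≤ (δ w v) (δ-edge e)) ⟩
      suc (δ w v + δ v b)     ≤⟨ s≤s split ⟩
      suc k                   ∎)

  module SelfCentred (d : ℕ) .{{_ : NonZero d}} (ecc≡d : ∀ u → ecc δ u ≡ d) (c : Fin n) where

    δ≤d : ∀ u v → δ u v ≤ d
    δ≤d u v = subst (δ u v ≤_) (ecc≡d u) (maxOver-upper (δ u) v)

    antipode : ∀ u → ∃ λ y → δ u y ≡ d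
    antipode u with y , uy≡ecc ← maxOver-attained (δ u) (subst (0 <_) (sym (ecc≡d u)) (>-nonZero⁻¹ d)) =
      y , trans uy≡ecc (ecc≡d u)

    z : Fin n
    z = proj₁ (antipode c)

    cz≡d : δ c z ≡ d
    cz≡d = proj₂ (antipode c)

    module _ {j v} (cv≡j : δ c v ≡ j) (only-v : ∀ {w} → δ c w ≡ j → w ≡ v) where

      through-v : ∀ {a b} → δ c a ≤ j → j ≤ δ c b → δ a v + δ v b ≤ δ a b
      through-v {a} {b} ca≤j j≤cb with v′ , cv′≡j , split ← walk-crosses-level c j (geodesic a b) ca≤j j≤cb =
        subst (λ x → δ a x + δ x b ≤ δ a b) (only-v cv′≡j) split

      antipode-below : ∀ {y} → δ v y ≡ d → δ c y ≤ j → j ≤ d → d ≤ j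
      antipode-below {y} vy≡d cy≤j j≤d = begin
        d               ≡⟨ sym cz≡d ⟩
        δ c z           ≤⟨ δ-triangle ⟩
        δ c v + δ v z   ≡⟨ cong₂ _+_ cv≡j vz≡0 ⟩
        j + 0           ≡⟨ +-identityʳ j ⟩
        j               ∎
        where
          vz≡0 : δ v z ≡ 0
          vz≡0 = n≤0⇒n≡0 (+-cancelˡ-≤ d _ _ (begin
            d + δ v z       ≡⟨ cong (_+ δ v z) (trans (sym vy≡d) δ-sym) ⟩
            δ y v + δ v z   ≤⟨ through-v cy≤j (subst (j ≤_) (sym cz≡d) j≤d) ⟩
            δ y z           ≤⟨ δ≤d y z ⟩
            d               ≡⟨ sym (+-identityʳ d) ⟩
            d + 0           ∎))

      antipode-above : ∀ {y} → δ v y ≡ d → j ≤ δ c y → j ≤ 0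
      antipode-above {y} vy≡d j≤cy = +-cancelʳ-≤ d j 0 (begin
        j + d           ≡⟨ cong₂ _+_ (sym cv≡j) (sym vy≡d) ⟩
        δ c v + δ v y   ≤⟨ through-v (subst (_≤ j) (sym δ-refl) z≤n) j≤cy ⟩
        δ c y           ≤⟨ δ≤d c y ⟩
        d               ∎)

      singleton-level : 0 < j → j < d → ⊥
      singleton-level 0<j j<d with y , vy≡d ← antipode v with ≤-total (δ c y) j
      ... | inj₁ cy≤j = <⇒≱ j<d (antipode-below vy≡d cy≤j (<⇒≤ j<d))
      ... | inj₂ j≤cy = <⇒≱ 0<j (antipode-above vy≡d j≤cy)

    -- Folding level d onto level 0 pairs c with z.
    folded : Fin n → ℕ
    folded v = δ c v % d

    at-level : ∀ {v j} → δ c v ≡ j → j < d → folded v ≡ j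
    at-level cv≡j j<d = trans (cong (_% d) cv≡j) (m<n⇒m%n≡m j<d)

    two-at-level : ∀ j → j < d → TwoAtLevel folded j
    two-at-level zero 0<d = c , z , c≢z , at-level δ-refl 0<d , trans (cong (_% d) cz≡d) (n%n≡0 d)
      where
        c≢z : c ≢ z
        c≢z c≡z = <⇒≢ 0<d (trans (sym δ-refl) (trans (cong (δ c) c≡z) cz≡d))
    two-at-level j@(suc _) j<d
      with v , cv≡j , _ ← walk-crosses-level c j (geodesic c z) (subst (_≤ j) (sym δ-refl) z≤n)
                                              (subst (j ≤_) (sym cz≡d) (<⇒≤ j<d))
      with Fin.any? (λ w → ¬? (w Fin.≟ v) ×-dec (δ c w ≟ j))
    ... | yes (w , w≢v , cw≡j) = w , v , w≢v , at-level cw≡j j<d , at-level cv≡j j<d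
    ... | no ∄ = ⊥-elim (singleton-level cv≡j only-v z<s j<d)
      where
        only-v : ∀ {w} → δ c w ≡ j → w ≡ v
        only-v {w} cw≡j = decidable-stable (w Fin.≟ v) (λ w≢v → ∄ (w , w≢v , cw≡j))

    2d≤n : 2 * d ≤ n
    2d≤n = subst (_≤ n) (*-comm d 2) (twoPerLevel⇒≤ folded d two-at-level)

  selfCentred⇒2diam≤n : (∀ u → ecc δ u ≡ diam δ) → 2 * diam δ ≤ n
  selfCentred⇒2diam≤n ecc≡diam with diam δ in diam≡
  ... | zero      = z≤n
  ... | d@(suc _) = SelfCentred.2d≤n d ecc≡diam c
    where
      c : Fin n
      c = proj₁ (maxOver-attained (ecc δ) (subst (0 <_) (sym diam≡) z<s))

ecc≤diam : ∀ {n} (δ : Fin n → Fin n → ℕ) u → ecc δ u ≤ diam δ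
ecc≤diam δ = maxOver-upper (ecc δ)

-- Connectedness is implied by the existence of the distance function δ.
lemma2p6 : (n : ℕ) (G : Graph n) → Connected G →
           (δ : Fin n → Fin n → ℕ) → IsDistance G δ →
           n < 2 * diam δ →
           (sumEcc δ < n * diam δ) × (sigma1 δ < n * (diam δ * diam δ))
lemma2p6 n G _ δ isδ n<2D with Fin.any? (λ u → ecc δ u <? diam δ)
... | yes (u , εu<D) =
  sumOver-< (ecc δ) (ecc≤diam δ) u εu<D ,
  sumOver-< (λ v → ecc δ v * ecc δ v) (λ v → *-mono-≤ (ecc≤diam δ v) (ecc≤diam δ v)) u (*-mono-< εu<D εu<D)
... | no ∄ = ⊥-elim (<⇒≱ n<2D (Distance.selfCentred⇒2diam≤n isδ selfCentred))
  where
    selfCentred : ∀ u → ecc δ u ≡ diam δ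
    selfCentred u = ≤-antisym (ecc≤diam δ u) (≮⇒≥ (λ εu<D → ∄ (u , εu<D)))
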